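{- Let $N \ge 1$ and let $G_N$ be the divisibility graph on $X_N=\{1,\dots,N\}$. For $p \in X_N$, the degree of $p$ in $G_N$ satisfies $k_p = \left\lfloor \frac{N}{p} \right\rfloor$ if and only if $p$ is a prime number.
   Context: The divisibility graph $G_N$ is the simple undirected graph with vertex set $X_N=\{1,\dots,N\}$, in which two distinct vertices $i \ne j$ are adjacent if and only if $i$ divides $j$ or $j$ divides $i$ (no loops). The degree $k_n$ of a vertex $n$ is the number of vertices adjacent to $n$. $\lfloor x \rfloor$ denotes the floor of $x$. -}

module Defs where

open import Data.Nat using (ℕ; zero; suc; _≟_)
open import Data.Nat.Divisibility using (_∣_; _∣?_)
open import Data.List using (List; length; filter; upTo; map)
open import Data.Sum using (_⊎_)
open import Relation.Binary.PropositionalEquality using (_≡_)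
open import Data.Product using (_×_)
open import Relation.Nullary using (¬_; Dec)
open import Relation.Nullary.Decidable using (_×-dec_; _⊎-dec_; ¬?)

vertices : ℕ → List ℕ
vertices N = map suc (upTo N)

Adjacent : ℕ → ℕ → Set
Adjacent i j = (¬ i ≡ j) × (i ∣ j ⊎ j ∣ i)

adjacent? : (i j : ℕ) → Dec (Adjacent i j)
adjacent? i j = ¬? (i ≟ j) ×-dec ((i ∣? j) ⊎-dec (j ∣? i))

degree : ℕ → ℕ → ℕ
degree N n = length (filter (adjacent? n) (vertices N))

-- For p ≤ N, the neighbours of p in G_N are its multiples in X_N (there are ⌊N/p⌋ of them) and its
-- divisors (τ(p) of them), except p itself, which is counted in both; no other vertex is both a
-- multiple and a divisor of p.  So k_p + 2 = ⌊N/p⌋ + τ(p), and k_p = ⌊N/p⌋ iff τ(p) = 2 iff p is prime.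
module Submission where

open import Defs
open import Data.Nat using (ℕ; _≤_; _/_; NonZero)
open import Data.Nat.Primality using (Prime)
open import Function.Bundles using (_⇔_)
open import Relation.Binary.PropositionalEquality using (_≡_)

open import Data.Nat using (zero; suc; _+_; _*_; _<_; _%_; _≟_; z≤n; s≤s)
open import Data.Nat.Properties
open import Data.Nat.DivMod
open import Data.Nat.Divisibility
open import Data.Nat.Primality using (Composite; prime; composite; ¬prime[1])
open import Data.List using ([]; _∷_; length; filter; map; upTo; _++_)
open import Data.List.Properties using (upTo-∷ʳ; map-++; filter-++; length-++)
open import Data.Sum using (inj₁; inj₂)
open import Algebra.Properties.CommutativeSemigroup +-commutativeSemigroup using (interchange)
open import Level using (0ℓ)
open import Function.Base using (_∘_)
open import Function.Bundles using (mk⇔; Equivalence)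
open import Function.Properties.Equivalence using () renaming (trans to ⇔-trans; sym to ⇔-sym)
open import Relation.Nullary using (Dec; yes; no; ¬_; contradiction)
open import Relation.Unary using (Pred; Decidable)
open import Relation.Binary.PropositionalEquality using (refl; sym; trans; cong; cong₂; module ≡-Reasoning)

open ≡-Reasoning

indicator : {A : Set} → Dec A → ℕ
indicator (yes _) = 1
indicator (no _)  = 0

indicator-yes : {A : Set} (a? : Dec A) → A → indicator a? ≡ 1
indicator-yes (yes _) _ = refl
indicator-yes (no ¬a) a = contradiction a ¬a

indicator-no : {A : Set} (a? : Dec A) → ¬ A → indicator a? ≡ 0
indicator-no (yes a) ¬a = contradiction a ¬a
indicator-no (no _)  _  = refl

sumTo : ℕ → (ℕ → ℕ) → ℕ
sumTo zero    f = 0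
sumTo (suc n) f = sumTo n f + f (suc n)

sumTo-cong : ∀ n {f g : ℕ → ℕ} → (∀ j → f j ≡ g j) → sumTo n f ≡ sumTo n g
sumTo-cong zero    f≗g = refl
sumTo-cong (suc n) f≗g = cong₂ _+_ (sumTo-cong n f≗g) (f≗g (suc n))

sumTo-+ : ∀ n (f g : ℕ → ℕ) → sumTo n (λ j → f j + g j) ≡ sumTo n f + sumTo n g
sumTo-+ zero    f g = refl
sumTo-+ (suc n) f g = begin
  sumTo n (λ j → f j + g j) + (f (suc n) + g (suc n))
    ≡⟨ cong (_+ (f (suc n) + g (suc n))) (sumTo-+ n f g) ⟩
  sumTo n f + sumTo n g + (f (suc n) + g (suc n))
    ≡⟨ interchange (sumTo n f) (sumTo n g) (f (suc n)) (g (suc n)) ⟩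
  sumTo n f + f (suc n) + (sumTo n g + g (suc n)) ∎

count : {P : Pred ℕ 0ℓ} → Decidable P → ℕ → ℕ
count P? n = sumTo n (indicator ∘ P?)

length-filter-vertices : ∀ {P : Pred ℕ 0ℓ} (P? : Decidable P) n → length (filter P? (vertices n)) ≡ count P? n
length-filter-vertices P? zero    = refl
length-filter-vertices P? (suc n) = begin
  length (filter P? (vertices (suc n)))
    ≡⟨ cong (length ∘ filter P?) vertices-suc ⟩
  length (filter P? (vertices n ++ suc n ∷ []))
    ≡⟨ cong length (filter-++ P? (vertices n) (suc n ∷ [])) ⟩
  length (filter P? (vertices n) ++ filter P? (suc n ∷ []))
    ≡⟨ length-++ (filter P? (vertices n)) ⟩
  length (filter P? (vertices n)) + length (filter P? (suc n ∷ []))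
    ≡⟨ cong₂ _+_ (length-filter-vertices P? n) length-filter-singleton ⟩
  count P? (suc n) ∎
  where
  vertices-suc : vertices (suc n) ≡ vertices n ++ suc n ∷ []
  vertices-suc = trans (cong (map suc) (sym (upTo-∷ʳ n))) (map-++ suc (upTo n) (n ∷ []))
  length-filter-singleton : length (filter P? (suc n ∷ [])) ≡ indicator (P? (suc n))
  length-filter-singleton with P? (suc n)
  ... | yes _ = refl
  ... | no _  = refl

module _ {P : Pred ℕ 0ℓ} (P? : Decidable P) where

  count≡0⇔none : ∀ n → count P? n ≡ 0 ⇔ (∀ {j} → 1 ≤ j → j ≤ n → ¬ P j)
  count≡0⇔none n = mk⇔ (to n) (from n)
    where
    to : ∀ n → count P? n ≡ 0 → ∀ {j} → 1 ≤ j → j ≤ n → ¬ P j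
    to zero    _   (s≤s _) ()
    to (suc n) c≡0 {j} 1≤j j≤1+n Pj with m≤n⇒m<n∨m≡n j≤1+n
    ... | inj₁ (s≤s j≤n) = to n (m+n≡0⇒m≡0 _ c≡0) 1≤j j≤n Pj
    ... | inj₂ refl      = contradiction (trans (sym (indicator-yes (P? j) Pj)) (m+n≡0⇒n≡0 _ c≡0)) λ ()
    from : ∀ n → (∀ {j} → 1 ≤ j → j ≤ n → ¬ P j) → count P? n ≡ 0
    from zero    none = refl
    from (suc n) none = cong₂ _+_ (from n λ 1≤j j≤n → none 1≤j (m≤n⇒m≤1+n j≤n))
                                  (indicator-no (P? (suc n)) (none (s≤s z≤n) ≤-refl))

  count-bounded : ∀ {m n} → (∀ {j} → P j → j ≤ m) → m ≤ n → count P? n ≡ count P? m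
  count-bounded {n = zero}  _     z≤n = refl
  count-bounded {m} {suc n} bound m≤1+n with m≤n⇒m<n∨m≡n m≤1+n
  ... | inj₂ refl      = refl
  ... | inj₁ (s≤s m≤n) = begin
    count P? n + indicator (P? (suc n)) ≡⟨ cong (count P? n +_) (indicator-no (P? (suc n)) (<⇒≱ (s≤s m≤n) ∘ bound)) ⟩
    count P? n + 0                      ≡⟨ +-identityʳ _ ⟩
    count P? n                          ≡⟨ count-bounded bound m≤n ⟩
    count P? m                          ∎

  count-shift : ∀ n → count P? (suc n) ≡ indicator (P? 1) + count (P? ∘ suc) n
  count-shift zero    = +-comm 0 _
  count-shift (suc n) = trans (cong (_+ indicator (P? (suc (suc n)))) (count-shift n))
                                (+-assoc (indicator (P? 1)) (count (P? ∘ suc) n) (indicator (P? (suc (suc n)))))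

count-≟≡1 : ∀ {p n} → 1 ≤ p → p ≤ n → count (p ≟_) n ≡ 1
count-≟≡1 {suc q} {n} _ p≤n = begin
  count (suc q ≟_) n
    ≡⟨ count-bounded (suc q ≟_) (λ { refl → ≤-refl }) p≤n ⟩
  count (suc q ≟_) q + indicator (suc q ≟ suc q)
    ≡⟨ cong₂ _+_ (Equivalence.from (count≡0⇔none (suc q ≟_) q) λ _ j≤q → <⇒≢ (s≤s j≤q) ∘ sym)
                 (indicator-yes (suc q ≟ suc q) refl) ⟩
  1 ∎

module _ {p} .{{_ : NonZero p}} (n : ℕ) where

  private
    1+n≡1+n%p+n/p*p : suc n ≡ suc (n % p) + n / p * p
    1+n≡1+n%p+n/p*p = cong suc (m≡m%n+[m/n]*n n p)

  p∣1+n⇒[1+n]/p≡1+n/p : p ∣ suc n → suc n / p ≡ suc (n / p)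
  p∣1+n⇒[1+n]/p≡1+n/p p∣1+n = begin
    suc n / p                     ≡⟨ /-congˡ 1+n≡1+n%p+n/p*p ⟩
    (suc (n % p) + n / p * p) / p ≡⟨ /-congˡ (cong (_+ n / p * p) 1+n%p≡p) ⟩
    suc (n / p) * p / p           ≡⟨ m*n/n≡m (suc (n / p)) p ⟩
    suc (n / p)                   ∎
    where
    1+n%p≡p : suc (n % p) ≡ p
    1+n%p≡p = trans (cong suc (%-pred-≡0 (n∣m⇒m%n≡0 (suc n) p p∣1+n))) (suc-pred p)

  p∤1+n⇒[1+n]/p≡n/p : ¬ p ∣ suc n → suc n / p ≡ n / p
  p∤1+n⇒[1+n]/p≡n/p p∤1+n = begin
    suc n / p                       ≡⟨ /-congˡ 1+n≡1+n%p+n/p*p ⟩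
    (suc (n % p) + n / p * p) / p   ≡⟨ +-distrib-/-∣ʳ (suc (n % p)) (n∣m*n (n / p)) ⟩
    suc (n % p) / p + n / p * p / p ≡⟨ cong₂ _+_ (m<n⇒m/n≡0 1+n%p<p) (m*n/n≡m (n / p) p) ⟩
    n / p                           ∎
    where
    1+n%p<p : suc (n % p) < p
    1+n%p<p = ≤∧≢⇒< (m%n<n n p) λ 1+n%p≡p →
      p∤1+n (divides (suc (n / p)) (trans 1+n≡1+n%p+n/p*p (cong (_+ n / p * p) 1+n%p≡p)))

count-multiples : ∀ p .{{_ : NonZero p}} n → count (p ∣?_) n ≡ n / p
count-multiples p zero    = sym (0/n≡0 p)
count-multiples p (suc n) with p ∣? suc n
... | yes p∣1+n = begin
  count (p ∣?_) n + 1 ≡⟨ +-comm (count (p ∣?_) n) 1 ⟩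
  suc (count (p ∣?_) n) ≡⟨ cong suc (count-multiples p n) ⟩
  suc (n / p)           ≡⟨ p∣1+n⇒[1+n]/p≡1+n/p n p∣1+n ⟨
  suc n / p             ∎
... | no  p∤1+n = begin
  count (p ∣?_) n + 0 ≡⟨ +-identityʳ _ ⟩
  count (p ∣?_) n     ≡⟨ count-multiples p n ⟩
  n / p               ≡⟨ p∤1+n⇒[1+n]/p≡n/p n p∤1+n ⟨
  suc n / p           ∎

divisorCount : ℕ → ℕ
divisorCount p = count (_∣? p) p

¬Composite⇔no-divisor-between : ∀ k → (¬ Composite (2 + k)) ⇔ (∀ {j} → 1 ≤ j → j ≤ k → ¬ suc j ∣ 2 + k)
¬Composite⇔no-divisor-between k = mk⇔
  (λ { ¬composite {suc j} _ j≤k d∣p → ¬composite (composite (s≤s (s≤s j≤k)) d∣p) })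
  (λ { none (composite {suc (suc j)} (s≤s (s≤s j≤k)) d∣p) → none (s≤s z≤n) j≤k d∣p })

divisorCount≡2⇔Prime : ∀ p .{{_ : NonZero p}} → divisorCount p ≡ 2 ⇔ Prime p
divisorCount≡2⇔Prime 1 = mk⇔ (λ ()) (λ prime[1] → contradiction prime[1] ¬prime[1])
divisorCount≡2⇔Prime p@(suc (suc k)) =
  ⇔-trans divisorCount≡2⇔c≡0
  (⇔-trans (count≡0⇔none (λ j → suc j ∣? p) k)
  (⇔-trans (⇔-sym (¬Composite⇔no-divisor-between k))
           (mk⇔ prime Prime.notComposite)))
  where
  c = count (λ j → suc j ∣? p) k
  divisorCount≡2+c : divisorCount p ≡ 2 + c
  divisorCount≡2+c = begin
    count (_∣? p) (suc k) + indicator (p ∣? p)  ≡⟨ cong₂ _+_ (count-shift (_∣? p) k) (indicator-yes (p ∣? p) ∣-refl) ⟩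
    indicator (1 ∣? p) + c + 1                  ≡⟨ cong (λ i → i + c + 1) (indicator-yes (1 ∣? p) (1∣ p)) ⟩
    1 + c + 1                                   ≡⟨ +-comm (1 + c) 1 ⟩
    2 + c                                       ∎
  divisorCount≡2⇔c≡0 : divisorCount p ≡ 2 ⇔ c ≡ 0
  divisorCount≡2⇔c≡0 = mk⇔ (suc-injective ∘ suc-injective ∘ trans (sym divisorCount≡2+c))
                           (trans divisorCount≡2+c ∘ cong (2 +_))

-- Matching on the three decisions also fixes adjacent? i j, which is built from them.
adjacent+2·equal≡divides+divided : ∀ i j →
  indicator (adjacent? i j) + (indicator (i ≟ j) + indicator (i ≟ j)) ≡ indicator (i ∣? j) + indicator (j ∣? i)
adjacent+2·equal≡divides+divided i j with i ≟ j | i ∣? j | j ∣? i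
... | yes refl | yes _   | yes _   = refl
... | yes refl | no i∤i  | _       = contradiction ∣-refl i∤i
... | yes refl | yes _   | no i∤i  = contradiction ∣-refl i∤i
... | no i≢j   | yes i∣j | yes j∣i = contradiction (∣-antisym i∣j j∣i) i≢j
... | no _     | yes _   | no _    = refl
... | no _     | no _    | yes _   = refl
... | no _     | no _    | no _    = refl

degree+2≡N/p+divisorCount : ∀ N p .{{_ : NonZero p}} → p ≤ N → degree N p + 2 ≡ N / p + divisorCount p
degree+2≡N/p+divisorCount N p@(suc _) p≤N = begin
  degree N p + 2
    ≡⟨ cong₂ _+_ (length-filter-vertices (adjacent? p) N) (sym (cong₂ _+_ p-once p-once)) ⟩
  count (adjacent? p) N + (count (p ≟_) N + count (p ≟_) N)
    ≡⟨ cong (count (adjacent? p) N +_) (sym (sumTo-+ N _ _)) ⟩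
  count (adjacent? p) N + sumTo N (λ j → indicator (p ≟ j) + indicator (p ≟ j))
    ≡⟨ sym (sumTo-+ N _ _) ⟩
  sumTo N (λ j → indicator (adjacent? p j) + (indicator (p ≟ j) + indicator (p ≟ j)))
    ≡⟨ sumTo-cong N (adjacent+2·equal≡divides+divided p) ⟩
  sumTo N (λ j → indicator (p ∣? j) + indicator (j ∣? p))
    ≡⟨ sumTo-+ N _ _ ⟩
  count (p ∣?_) N + count (_∣? p) N
    ≡⟨ cong₂ _+_ (count-multiples p N) (count-bounded (_∣? p) ∣⇒≤ p≤N) ⟩
  N / p + divisorCount p ∎
  where
  p-once : count (p ≟_) N ≡ 1
  p-once = count-≟≡1 (s≤s z≤n) p≤N

corollary1 : (N p : ℕ) .{{_ : NonZero p}} → 1 ≤ N → p ≤ N →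
    (degree N p ≡ N / p) ⇔ Prime p
corollary1 N p _ p≤N = ⇔-trans (mk⇔ to from) (divisorCount≡2⇔Prime p)
  where
  degree-formula = degree+2≡N/p+divisorCount N p p≤N
  to : degree N p ≡ N / p → divisorCount p ≡ 2
  to degree≡ = +-cancelˡ-≡ (N / p) _ _ (trans (sym degree-formula) (cong (_+ 2) degree≡))
  from : divisorCount p ≡ 2 → degree N p ≡ N / p
  from τ≡2 = +-cancelʳ-≡ 2 _ _ (trans degree-formula (cong (N / p +_) τ≡2))
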